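{- For every graph $H$ there is a constant $C_H$ such that every $H$-free graph $G$ on $n$ vertices satisfies $\mathrm{dg}(G)\le C_H\,\mathrm{ex}(n,H)/n$.
   Context: All graphs are finite and simple. A graph is $H$-free if it contains no (not necessarily induced) subgraph isomorphic to $H$. $\mathrm{ex}(n,H)$ is the maximum number of edges of an $H$-free graph on $n$ vertices. The degeneracy $\mathrm{dg}(G)$ is the maximum of $\delta(G')$ over all non-empty induced subgraphs $G'$ of $G$, where $\delta$ denotes minimum degree. -}

module Defs where

open import Data.Nat using (ℕ; zero; suc; _+_; _*_; _≤_; _⊔_; _⊓_; _<ᵇ_)
open import Data.Bool using (Bool; true; false; _∧_; if_then_else_)
open import Data.Fin using (Fin; toℕ)
open import Data.Vec using (Vec; []; _∷_; lookup)
open import Data.List using (List; []; _∷_; map; foldr; allFin; filter; concatMap)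
open import Data.Nat.ListAction using (sum)
open import Data.Product using (Σ; _×_; ∃; ∃-syntax)
open import Function.Definitions using (Injective)
open import Relation.Binary.PropositionalEquality using (_≡_)
open import Relation.Nullary using (¬_)

record Graph (n : ℕ) : Set where
  field
    adj    : Fin n → Fin n → Bool
    sym    : ∀ i j → adj i j ≡ adj j i
    irrefl : ∀ i → adj i i ≡ false
open Graph public

edges : ∀ {n} → Graph n → ℕ
edges {n} G = sum (map (λ i → sum (map (λ j →
  if adj G i j ∧ (toℕ i <ᵇ toℕ j) then 1 else 0) (allFin n))) (allFin n))

-- A (not necessarily induced) copy of H in G: an injective edge-preserving vertex map.
record Copy {h n : ℕ} (H : Graph h) (G : Graph n) : Set where
  field
    f        : Fin h → Fin n
    inj      : Injective _≡_ _≡_ f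
    preserve : ∀ i j → adj H i j ≡ true → adj G (f i) (f j) ≡ true

Free : ∀ {h n} → Graph h → Graph n → Set
Free H G = ¬ Copy H G

IsEx : ∀ {h} → ℕ → Graph h → ℕ → Set
IsEx {h} n H e =
  (Σ (Graph n) λ G → Free H G × edges G ≡ e) × (∀ (G : Graph n) → Free H G → edges G ≤ e)

allSubsets : ∀ n → List (Vec Bool n)
allSubsets zero = [] ∷ []
allSubsets (suc n) = concatMap (λ s → (true ∷ s) ∷ (false ∷ s) ∷ []) (allSubsets n)

degIn : ∀ {n} → Graph n → Vec Bool n → Fin n → ℕ
degIn {n} G S v = sum (map (λ u → if lookup S u ∧ adj G v u then 1 else 0) (allFin n))

minList : List ℕ → ℕ
minList [] = 0
minList (x ∷ xs) = foldr _⊓_ x xs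

-- Minimum degree δ(G[S]) of the induced subgraph on S (0 if S is empty).
minDegIn : ∀ {n} → Graph n → Vec Bool n → ℕ
minDegIn {n} G S = minList (map (degIn G S) (filter (λ v → Data.Bool._≟_ (lookup S v) true) (allFin n)))
  where import Data.Bool

-- Degeneracy: maximum of δ(G[S]) over vertex subsets S (the empty S contributes 0,
-- which does not affect the maximum; dg of the empty graph is 0).
dg : ∀ {n} → Graph n → ℕ
dg {n} G = foldr _⊔_ 0 (map (minDegIn G) (allSubsets n))

module Submission where

-- Let d = dg(G) ≥ 1 and let T be a core of G: a non-empty vertex set such that G[T] has
-- minimum degree d (dg-core).  Two lower bounds for ex(n, H) are combined.
--  * Dense case, d ≥ 2h.  Put D = d − h ≥ d/2.  A blow-up (vertex-disjoint copies filling n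
--    vertices) of a graph of minimum degree D has at least Dn/4 edges (blowup-edges).  If all
--    blow-ups of subgraphs G[T′] with minimum degree D contained H, then H could be embedded
--    into G itself, block by block: the part of H landing in one copy embeds into G[T′], and
--    deleting its image lowers degrees by at most its size (Peel, Embed).  As G is H-free, some
--    such blow-up is H-free, so ex(n, H) ≥ Dn/4 ≥ dn/8 (dense-bound).
--  * Sparse case, 1 ≤ d < 2h.  The near-perfect matching and the star on n vertices both have
--    at least n/4 edges; a graph inside both has at most one edge, hence would embed into G.
--    So ex(n, H) ≥ n/4 > dn/(8h) (sparse-bound).

open import Defs hiding (sym)
open import Data.Nat as ℕ
  using (ℕ; zero; suc; _+_; _*_; _∸_; _≤_; _<_; z≤n; s≤s; _<ᵇ_; _≡ᵇ_; _⊔_; _⊓_; _≤?_; NonZero)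
open import Data.Nat.Properties hiding (_≟_)
open import Data.Nat.DivMod
  using (_/_; _%_; _mod_; m≡m%n+[m/n]*n; m*n/n≡m; m<n⇒m/n≡0; m<n⇒m%n≡m; [m+kn]%n≡m%n;
         +-distrib-/-∣ˡ; m/n*n≤m; m<n*o⇒m/o<n; m≥n⇒m/n>0; m%n<n)
open import Data.Nat.Divisibility using (divides)
open import Data.Nat.ListAction renaming (sum to listSum)
open import Data.Nat.Tactic.RingSolver using (solve-∀)
open import Algebra.Properties.CommutativeMonoid.Sum +-0-commutativeMonoid
  using (sum-syntax; ∑-distrib-+; ∑-comm; sum-remove; sum-cong-≗; sum-replicate-zero)
open import Data.Bool using (Bool; true; false; if_then_else_; _∧_; not; _xor_; _≟_)
open import Data.Bool.Properties using (T-≡; ∧-zeroʳ; ∧-identityʳ; xor-comm; xor-same)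
open import Data.Fin as Fin using (Fin; zero; suc; toℕ; fromℕ<; inject≤; punchIn; punchOut)
open import Data.Fin.Properties
  using (toℕ-injective; toℕ<n; toℕ-fromℕ<; toℕ-inject≤; inject≤-injective;
         punchIn-punchOut; punchOut-injective; injective⇒≤; any?)
  renaming (suc-injective to fsuc-injective)
open import Data.Fin.Permutation.Components using (transpose; transpose-inverse)
open import Data.List using (List; []; _∷_; map; foldr; allFin; tabulate; filter)
open import Data.List.Properties using (map-tabulate)
open import Data.List.Membership.Propositional using (_∈_)
open import Data.List.Membership.Propositional.Properties using (∈-filter⁺; ∈-filter⁻; ∈-allFin)
open import Data.List.Relation.Unary.Any using (here; there)
open import Data.Vec using (lookup)
open import Data.Product using (Σ-syntax; _×_; _,_; ∃-syntax; proj₂)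
open import Data.Sum using (_⊎_; inj₁; inj₂)
open import Data.Empty using (⊥; ⊥-elim)
open import Function using (_∘_; id)
open import Function.Bundles using (Equivalence)
open import Function.Definitions using (Injective)
open import Relation.Binary using (tri<; tri≈; tri>)
open import Relation.Binary.PropositionalEquality
open import Relation.Nullary using (¬_; yes; no)
open import Relation.Nullary.Decidable using (decidable-stable; dec-true; dec-false)

⟦_⟧ : Bool → ℕ
⟦ b ⟧ = if b then 1 else 0

⟦⟧≤1 : ∀ b → ⟦ b ⟧ ≤ 1
⟦⟧≤1 true  = s≤s z≤n
⟦⟧≤1 false = z≤n

indicator-positive : ∀ {b} → 0 < ⟦ b ⟧ → b ≡ true
indicator-positive {true} _ = refl

true≢false : ∀ {b} → b ≡ true → b ≡ false → ⊥
true≢false refl ()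

∧-true-left : ∀ a b → (a ∧ b) ≡ true → a ≡ true
∧-true-left true b _ = refl

∧-true-right : ∀ a b → (a ∧ b) ≡ true → b ≡ true
∧-true-right true b e = e

<ᵇ-true : ∀ {a b} → a < b → (a <ᵇ b) ≡ true
<ᵇ-true a<b = Equivalence.to T-≡ (<⇒<ᵇ a<b)

≡ᵇ-refl : ∀ k → (k ≡ᵇ k) ≡ true
≡ᵇ-refl k = Equivalence.to T-≡ (≡⇒≡ᵇ k k refl)

≡ᵇ-true : ∀ a b → (a ≡ᵇ b) ≡ true → a ≡ b
≡ᵇ-true a b e = ≡ᵇ⇒≡ a b (Equivalence.from T-≡ e)

≡ᵇ-sym : ∀ a b → (a ≡ᵇ b) ≡ (b ≡ᵇ a)
≡ᵇ-sym zero    zero    = refl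
≡ᵇ-sym zero    (suc b) = refl
≡ᵇ-sym (suc a) zero    = refl
≡ᵇ-sym (suc a) (suc b) = ≡ᵇ-sym a b

listSum-tabulate : ∀ n (g : Fin n → ℕ) → listSum (tabulate g) ≡ ∑[ i < n ] g i
listSum-tabulate zero    g = refl
listSum-tabulate (suc n) g = cong (g zero +_) (listSum-tabulate n (g ∘ suc))

listSum-allFin : ∀ n (g : Fin n → ℕ) → listSum (map g (allFin n)) ≡ ∑[ i < n ] g i
listSum-allFin n g = trans (cong listSum (map-tabulate id g)) (listSum-tabulate n g)

∑-mono : ∀ n {f g : Fin n → ℕ} → (∀ i → f i ≤ g i) → ∑[ i < n ] f i ≤ ∑[ i < n ] g i
∑-mono zero    f≤g = z≤n
∑-mono (suc n) f≤g = +-mono-≤ (f≤g zero) (∑-mono n (f≤g ∘ suc))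

term≤∑ : ∀ n (f : Fin n → ℕ) p → f p ≤ ∑[ i < n ] f i
term≤∑ (suc n) f zero    = m≤m+n _ _
term≤∑ (suc n) f (suc p) = ≤-trans (term≤∑ n (f ∘ suc) p) (m≤n+m _ _)

∑-positive : ∀ n (f : Fin n → ℕ) → 0 < ∑[ i < n ] f i → ∃[ i ] 0 < f i
∑-positive (suc n) f pos with f zero in eq
... | suc _ = zero , subst (0 <_) (sym eq) (s≤s z≤n)
... | zero  with ∑-positive n (f ∘ suc) pos
...   | i , fi>0 = suc i , fi>0

const≤∑ : ∀ n c (f : Fin n → ℕ) → (∀ i → c ≤ f i) → n * c ≤ ∑[ i < n ] f i
const≤∑ zero    c f c≤f = z≤n
const≤∑ (suc n) c f c≤f = +-mono-≤ (c≤f zero) (const≤∑ n c (f ∘ suc) (c≤f ∘ suc))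

∑≤n : ∀ n (f : Fin n → ℕ) → (∀ i → f i ≤ 1) → ∑[ i < n ] f i ≤ n
∑≤n zero    f f≤1 = z≤n
∑≤n (suc n) f f≤1 = +-mono-≤ (f≤1 zero) (∑≤n n (f ∘ suc) (f≤1 ∘ suc))

∑-reindex≤ : ∀ m n (g : Fin n → ℕ) (ι : Fin m → Fin n) → Injective _≡_ _≡_ ι →
             ∑[ r < m ] g (ι r) ≤ ∑[ u < n ] g u
∑-reindex≤ zero    n       g ι ι-inj = z≤n
∑-reindex≤ (suc m) zero    g ι ι-inj with ι zero
... | ()
∑-reindex≤ (suc m) (suc n) g ι ι-inj = begin
  g p + ∑[ r < m ] g (ι (suc r))
    ≡⟨ cong (g p +_) (sum-cong-≗ (λ r → cong g (sym (punchIn-punchOut (p≢ r))))) ⟩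
  g p + ∑[ r < m ] g (punchIn p (ι′ r))
    ≤⟨ +-monoʳ-≤ (g p) (∑-reindex≤ m n (g ∘ punchIn p) ι′ ι′-inj) ⟩
  g p + ∑[ w < n ] g (punchIn p w)
    ≡⟨ sum-remove g ⟨
  ∑[ u < suc n ] g u ∎
  where
  open ≤-Reasoning
  p = ι zero
  p≢ : ∀ r → p ≢ ι (suc r)
  p≢ r e with ι-inj e
  ... | ()
  ι′ : Fin m → Fin n
  ι′ r = punchOut (p≢ r)
  ι′-inj : Injective _≡_ _≡_ ι′
  ι′-inj e = fsuc-injective (ι-inj (punchOut-injective (p≢ _) (p≢ _) e))

deg : ∀ {n} → Graph n → (Fin n → Bool) → Fin n → ℕ
deg {n} G T v = ∑[ u < n ] ⟦ T u ∧ adj G v u ⟧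

degree : ∀ {n} → Graph n → Fin n → ℕ
degree {n} G v = ∑[ u < n ] ⟦ adj G v u ⟧

edges-∑ : ∀ {n} (G : Graph n) → edges G ≡ ∑[ i < n ] ∑[ j < n ] ⟦ adj G i j ∧ (toℕ i <ᵇ toℕ j) ⟧
edges-∑ {n} G = trans (listSum-allFin n _) (sum-cong-≗ (λ i → listSum-allFin n (λ j → ⟦ adj G i j ∧ (toℕ i <ᵇ toℕ j) ⟧)))

-- Handshake inequality: the ordered adjacent pair (u, v) is counted by the edge {u, v}.
handshake : ∀ {n} (G : Graph n) → ∑[ v < n ] degree G v ≤ 2 * edges G
handshake {n} G = begin
  ∑[ u < n ] ∑[ v < n ] ⟦ adj G u v ⟧
    ≤⟨ ∑-mono n (λ u → ∑-mono n (λ v → adjacent≤ordered u v)) ⟩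
  ∑[ u < n ] ∑[ v < n ] (E u v + E v u)
    ≡⟨ sum-cong-≗ (λ u → ∑-distrib-+ (E u) (λ v → E v u)) ⟩
  ∑[ u < n ] (∑[ v < n ] E u v + ∑[ v < n ] E v u)
    ≡⟨ ∑-distrib-+ (λ u → ∑[ v < n ] E u v) (λ u → ∑[ v < n ] E v u) ⟩
  ∑[ u < n ] ∑[ v < n ] E u v + ∑[ u < n ] ∑[ v < n ] E v u
    ≡⟨ cong (∑[ u < n ] ∑[ v < n ] E u v +_) (∑-comm (λ u v → E v u)) ⟩
  ∑[ u < n ] ∑[ v < n ] E u v + ∑[ u < n ] ∑[ v < n ] E u v
    ≡⟨ cong (λ x → x + x) (edges-∑ G) ⟨
  edges G + edges G
    ≡⟨ cong (edges G +_) (+-identityʳ (edges G)) ⟨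
  2 * edges G ∎
  where
  open ≤-Reasoning
  E : Fin n → Fin n → ℕ
  E u v = ⟦ adj G u v ∧ (toℕ u <ᵇ toℕ v) ⟧
  adjacent≤ordered : ∀ u v → ⟦ adj G u v ⟧ ≤ E u v + E v u
  adjacent≤ordered u v with <-cmp (toℕ u) (toℕ v)
  ... | tri< u<v _ _ rewrite <ᵇ-true u<v | ∧-identityʳ (adj G u v) = m≤m+n _ _
  ... | tri> _ _ v<u rewrite <ᵇ-true v<u | ∧-identityʳ (adj G v u) | Graph.sym G v u = m≤n+m _ _
  ... | tri≈ _ u≡v _ rewrite toℕ-injective u≡v | irrefl G v = z≤n

has-neighbour : ∀ {n} (G : Graph n) T v → 1 ≤ deg G T v → ∃[ u ] adj G v u ≡ true
has-neighbour {n} G T v deg≥1 with ∑-positive n (λ u → ⟦ T u ∧ adj G v u ⟧) deg≥1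
... | u , positive = u , ∧-true-right (T u) _ (indicator-positive positive)

max-attained : ∀ {A : Set} (f : A → ℕ) (xs : List A) →
  foldr _⊔_ 0 (map f xs) ≡ 0 ⊎ ∃[ x ] (foldr _⊔_ 0 (map f xs) ≡ f x)
max-attained f [] = inj₁ refl
max-attained f (x ∷ xs) with ⊔-sel (f x) (foldr _⊔_ 0 (map f xs))
... | inj₁ e = inj₂ (x , e)
... | inj₂ e with max-attained f xs
...   | inj₁ e′       = inj₁ (trans e e′)
...   | inj₂ (y , e′) = inj₂ (y , trans e e′)

min≤member : ∀ {A : Set} (f : A → ℕ) (xs : List A) x → x ∈ xs → minList (map f xs) ≤ f x
min≤member f (y ∷ ys) x x∈ = foldr⊓≤ (f y) (map f ys) (f x) (∈-map x∈)
  where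
  ∈-map : ∀ {zs} → x ∈ zs → f x ∈ map f zs
  ∈-map (here refl) = here refl
  ∈-map (there p)   = there (∈-map p)
  foldr⊓≤ : ∀ z zs w → w ∈ z ∷ zs → foldr _⊓_ z zs ≤ w
  foldr⊓≤ z []        w (here refl)         = ≤-refl
  foldr⊓≤ z (z′ ∷ zs) w (here refl)         = ≤-trans (m⊓n≤n z′ _) (foldr⊓≤ z zs w (here refl))
  foldr⊓≤ z (z′ ∷ zs) w (there (here refl)) = m⊓n≤m z′ _
  foldr⊓≤ z (z′ ∷ zs) w (there (there q))   = ≤-trans (m⊓n≤n z′ _) (foldr⊓≤ z zs w (there q))

dg-core : ∀ {n} (G : Graph n) → 1 ≤ dg G →
  Σ[ T ∈ (Fin n → Bool) ] (∃[ v ] T v ≡ true) × (∀ v → T v ≡ true → dg G ≤ deg G T v)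
dg-core {n} G dg≥1 with max-attained (minDegIn G) (allSubsets n)
... | inj₁ dg≡0       = ⊥-elim (1+n≰n (≤-trans dg≥1 (≤-reflexive dg≡0)))
... | inj₂ (S , dg≡δ) = lookup S , nonempty members (λ v → ∈-filter⁻ inS?) (subst (1 ≤_) dg≡δ dg≥1) , min-degree
  where
  inS? = λ v → lookup S v ≟ true
  members = filter inS? (allFin n)
  -- An empty S would have minimum degree 0, so S has a member.
  nonempty : ∀ vs → (∀ v → v ∈ vs → v ∈ allFin n × lookup S v ≡ true) →
             1 ≤ minList (map (degIn G S) vs) → ∃[ v ] lookup S v ≡ true
  nonempty (v ∷ _) mem _ = v , proj₂ (mem v (here refl))
  min-degree : ∀ v → lookup S v ≡ true → dg G ≤ deg G (lookup S) v
  min-degree v v∈S = begin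
    dg G                               ≡⟨ dg≡δ ⟩
    minDegIn G S                       ≤⟨ min≤member (degIn G S) members v (∈-filter⁺ inS? (∈-allFin v) v∈S) ⟩
    degIn G S v                        ≡⟨ listSum-allFin n _ ⟩
    deg G (lookup S) v ∎
    where open ≤-Reasoning

count : ∀ {n} → (Fin n → Bool) → ℕ
count {n} P = ∑[ u < n ] ⟦ P u ⟧

enum : ∀ {n} (P : Fin n → Bool) → Fin (count P) → Fin n
enum {suc n} P r with P zero
enum {suc n} P zero    | true  = zero
enum {suc n} P (suc r) | true  = suc (enum (P ∘ suc) r)
enum {suc n} P r       | false = suc (enum (P ∘ suc) r)

enum-member : ∀ {n} (P : Fin n → Bool) r → P (enum P r) ≡ true
enum-member {suc n} P r with P zero in P0
enum-member {suc n} P zero    | true  = P0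
enum-member {suc n} P (suc r) | true  = enum-member (P ∘ suc) r
enum-member {suc n} P r       | false = enum-member (P ∘ suc) r

enum-injective : ∀ {n} (P : Fin n → Bool) → Injective _≡_ _≡_ (enum P)
enum-injective {suc n} P {r} {s} e with P zero
enum-injective {suc n} P {zero}  {zero}  e  | true = refl
enum-injective {suc n} P {suc r} {suc s} e  | true = cong suc (enum-injective (P ∘ suc) (fsuc-injective e))
enum-injective {suc n} P {r}     {s}     e  | false = enum-injective (P ∘ suc) (fsuc-injective e)

count-enum : ∀ {n} (P Q : Fin n → Bool) → ∑[ r < count P ] ⟦ Q (enum P r) ⟧ ≡ count (λ u → P u ∧ Q u)
count-enum {zero}  P Q = refl
count-enum {suc n} P Q with P zero
... | true  = cong (⟦ Q zero ⟧ +_) (count-enum (P ∘ suc) (Q ∘ suc))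
... | false = count-enum (P ∘ suc) (Q ∘ suc)

count≤n : ∀ {n} (P : Fin n → Bool) → count P ≤ n
count≤n {n} P = ∑≤n n _ (λ u → ⟦⟧≤1 (P u))

count-nonzero : ∀ {n} (P : Fin n → Bool) → ∃[ v ] P v ≡ true → NonZero (count P)
count-nonzero {n} P (v , Pv) = ℕ.>-nonZero (≤-trans (≤-reflexive (cong ⟦_⟧ (sym Pv))) (term≤∑ n _ v))

induced : ∀ {m n} → Graph n → (Fin m → Fin n) → Graph m
induced G t = record
  { adj    = λ i j → adj G (t i) (t j)
  ; sym    = λ i j → Graph.sym G (t i) (t j)
  ; irrefl = λ i → irrefl G (t i)
  }

degree-induced : ∀ {n} (G : Graph n) (T : Fin n → Bool) r →
                 degree (induced G (enum T)) r ≡ deg G T (enum T r)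
degree-induced G T r = count-enum T (adj G (enum T r))

-- The blow-up of F : Graph m on n vertices: ⌊n/m⌋ vertex-disjoint copies of F, vertex u
-- playing the role of u mod m in the copy number ⌊u/m⌋ (the last n mod m vertices are isolated).
module Blowup {m} (F : Graph m) .{{_ : NonZero m}} (n : ℕ) where

  copies : ℕ
  copies = n / m

  block : Fin n → ℕ
  block u = toℕ u / m

  pos : Fin n → Fin m
  pos u = toℕ u mod m

  blowup-adj : Fin n → Fin n → Bool
  blowup-adj u v = (block u ≡ᵇ block v) ∧ ((block u <ᵇ copies) ∧ adj F (pos u) (pos v))

  blowup : Graph n
  blowup = record { adj = blowup-adj ; sym = symmetric ; irrefl = irreflexive }
    where
    symmetric : ∀ u v → blowup-adj u v ≡ blowup-adj v u
    symmetric u v with block u ≡ᵇ block v in e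
    ... | false = cong (_∧ ((block v <ᵇ copies) ∧ adj F (pos v) (pos u)))
                       (trans (sym e) (≡ᵇ-sym (block u) (block v)))
    ... | true rewrite ≡ᵇ-true (block u) (block v) e | ≡ᵇ-refl (block v)
                     | Graph.sym F (pos u) (pos v) = refl
    irreflexive : ∀ u → blowup-adj u u ≡ false
    irreflexive u rewrite irrefl F (pos u) | ∧-zeroʳ (block u <ᵇ copies) = ∧-zeroʳ _

  edge-block : ∀ u v → blowup-adj u v ≡ true → block u ≡ block v
  edge-block u v e = ≡ᵇ-true (block u) (block v) (∧-true-left (block u ≡ᵇ block v) _ e)

  edge-pos : ∀ u v → blowup-adj u v ≡ true → adj F (pos u) (pos v) ≡ true
  edge-pos u v e = ∧-true-right (block u <ᵇ copies) _ (∧-true-right (block u ≡ᵇ block v) _ e)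

  toℕ-pos : ∀ u → toℕ (pos u) ≡ toℕ u % m
  toℕ-pos u = toℕ-fromℕ< _

  block-pos-injective : ∀ u v → block u ≡ block v → pos u ≡ pos v → u ≡ v
  block-pos-injective u v bu≡bv pu≡pv = toℕ-injective (begin
    toℕ u                  ≡⟨ m≡m%n+[m/n]*n (toℕ u) m ⟩
    toℕ u % m + block u * m ≡⟨ cong₂ (λ a b → a + b * m) same-rem bu≡bv ⟩
    toℕ v % m + block v * m ≡⟨ m≡m%n+[m/n]*n (toℕ v) m ⟨
    toℕ v ∎)
    where
    open ≡-Reasoning
    same-rem : toℕ u % m ≡ toℕ v % m
    same-rem = trans (sym (toℕ-pos u)) (trans (cong toℕ pu≡pv) (toℕ-pos v))

  vertex : ∀ k (r : Fin m) → k * m + toℕ r < n → Fin n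
  vertex k r lt = fromℕ< lt

  block-vertex : ∀ k r lt → block (vertex k r lt) ≡ k
  block-vertex k r lt = begin
    toℕ (fromℕ< lt) / m     ≡⟨ cong (_/ m) (toℕ-fromℕ< lt) ⟩
    (k * m + toℕ r) / m     ≡⟨ +-distrib-/-∣ˡ (toℕ r) (divides k refl) ⟩
    k * m / m + toℕ r / m   ≡⟨ cong₂ _+_ (m*n/n≡m k m) (m<n⇒m/n≡0 (toℕ<n r)) ⟩
    k + 0                   ≡⟨ +-identityʳ k ⟩
    k ∎
    where open ≡-Reasoning

  pos-vertex : ∀ k r lt → pos (vertex k r lt) ≡ r
  pos-vertex k r lt = toℕ-injective (begin
    toℕ (pos (fromℕ< lt))   ≡⟨ toℕ-pos (fromℕ< lt) ⟩
    toℕ (fromℕ< lt) % m     ≡⟨ cong (_% m) (trans (toℕ-fromℕ< lt) (+-comm (k * m) (toℕ r))) ⟩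
    (toℕ r + k * m) % m     ≡⟨ [m+kn]%n≡m%n (toℕ r) k m ⟩
    toℕ r % m               ≡⟨ m<n⇒m%n≡m (toℕ<n r) ⟩
    toℕ r ∎)
    where open ≡-Reasoning

  degree-in-block : ∀ u → toℕ u < copies * m → degree F (pos u) ≤ degree blowup u
  degree-in-block u u<qm = begin
    ∑[ r < m ] ⟦ adj F (pos u) r ⟧      ≡⟨ sum-cong-≗ same-adjacency ⟩
    ∑[ r < m ] ⟦ blowup-adj u (ι r) ⟧  ≤⟨ ∑-reindex≤ m n (⟦_⟧ ∘ blowup-adj u) ι ι-injective ⟩
    degree blowup u ∎
    where
    open ≤-Reasoning
    bu<q : block u < copies
    bu<q = m<n*o⇒m/o<n u<qm
    in-range : ∀ r → block u * m + toℕ r < n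
    in-range r = begin-strict
      block u * m + toℕ r <⟨ +-monoʳ-< (block u * m) (toℕ<n r) ⟩
      block u * m + m     ≡⟨ +-comm (block u * m) m ⟩
      suc (block u) * m   ≤⟨ *-monoˡ-≤ m bu<q ⟩
      copies * m          ≤⟨ m/n*n≤m n m ⟩
      n ∎
    ι : Fin m → Fin n
    ι r = vertex (block u) r (in-range r)
    ι-injective : Injective _≡_ _≡_ ι
    ι-injective {r} {s} e =
      trans (sym (pos-vertex (block u) r (in-range r))) (trans (cong pos e) (pos-vertex (block u) s (in-range s)))
    same-adjacency : ∀ r → ⟦ adj F (pos u) r ⟧ ≡ ⟦ blowup-adj u (ι r) ⟧
    same-adjacency r rewrite block-vertex (block u) r (in-range r) | pos-vertex (block u) r (in-range r)
                           | ≡ᵇ-refl (block u) | <ᵇ-true bu<q = refl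

  n≤2·copies·m : m ≤ n → n ≤ 2 * (copies * m)
  n≤2·copies·m m≤n = begin
    n                       ≡⟨ m≡m%n+[m/n]*n n m ⟩
    n % m + copies * m      ≤⟨ +-monoˡ-≤ (copies * m) (<⇒≤ (m%n<n n m)) ⟩
    m + copies * m          ≤⟨ +-monoˡ-≤ (copies * m) m≤copies·m ⟩
    copies * m + copies * m ≡⟨ cong (copies * m +_) (+-identityʳ (copies * m)) ⟨
    2 * (copies * m) ∎
    where
    open ≤-Reasoning
    m≤copies·m : m ≤ copies * m
    m≤copies·m = ≤-trans (≤-reflexive (sym (*-identityˡ m))) (*-monoˡ-≤ m (m≥n⇒m/n>0 m≤n))

  blowup-edges : ∀ δ → (∀ r → δ ≤ degree F r) → m ≤ n → δ * n ≤ 4 * edges blowup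
  blowup-edges δ δ≤deg m≤n = begin
    δ * n                             ≤⟨ *-monoʳ-≤ δ (n≤2·copies·m m≤n) ⟩
    δ * (2 * (copies * m))            ≡⟨ *-comm δ _ ⟩
    2 * (copies * m) * δ              ≡⟨ *-assoc 2 (copies * m) δ ⟩
    2 * ((copies * m) * δ)            ≤⟨ *-monoʳ-≤ 2 full-blocks ⟩
    2 * ∑[ u < n ] degree blowup u    ≤⟨ *-monoʳ-≤ 2 (handshake blowup) ⟩
    2 * (2 * edges blowup)            ≡⟨ *-assoc 2 2 (edges blowup) ⟨
    4 * edges blowup ∎
    where
    open ≤-Reasoning
    qm≤n : copies * m ≤ n
    qm≤n = m/n*n≤m n m
    full-blocks : (copies * m) * δ ≤ ∑[ u < n ] degree blowup u
    full-blocks = ≤-trans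
      (const≤∑ (copies * m) δ (λ j → degree blowup (inject≤ j qm≤n))
        (λ j → ≤-trans (δ≤deg _) (degree-in-block (inject≤ j qm≤n)
                 (subst (_< copies * m) (sym (toℕ-inject≤ j qm≤n)) (toℕ<n j)))))
      (∑-reindex≤ (copies * m) n (degree blowup) (λ j → inject≤ j qm≤n)
        (λ {i} {j} → inject≤-injective qm≤n qm≤n i j))

record PartialCopy {h n} (H : Graph h) (G : Graph n) (P : Fin h → Bool) (T : Fin n → Bool) : Set where
  field
    to        : Fin h → Fin n
    into      : ∀ i → P i ≡ true → T (to i) ≡ true
    injective : ∀ i j → P i ≡ true → P j ≡ true → to i ≡ to j → i ≡ j
    preserve  : ∀ i j → P i ≡ true → P j ≡ true → adj H i j ≡ true → adj G (to i) (to j) ≡ true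

_≡ᶠ_ : ∀ {n} → Fin n → Fin n → Bool
x ≡ᶠ y = toℕ x ≡ᵇ toℕ y

≡ᶠ-refl : ∀ {n} (x : Fin n) → (x ≡ᶠ x) ≡ true
≡ᶠ-refl x = ≡ᵇ-refl (toℕ x)

count-≡ᶠ : ∀ {n} (x : Fin n) → count (x ≡ᶠ_) ≤ 1
count-≡ᶠ {suc n} zero    = ≤-reflexive (cong suc (sum-replicate-zero n))
count-≡ᶠ {suc n} (suc x) = count-≡ᶠ x

member≤count : ∀ {n} (P : Fin n → Bool) i → P i ≡ true → 1 ≤ count P
member≤count {n} P i Pi = ≤-trans (≤-reflexive (cong ⟦_⟧ (sym Pi))) (term≤∑ n _ i)

-- G[T] has minimum degree at least D + |P| and H embeds in the blow-up of
-- G[T].  The vertices P₁ of P landing in the block of i₀ embed into G[T] via their positions and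
-- have no H-edges to the rest P₂ of P.  Deleting their image R from T costs every vertex at most
-- |P₁| neighbours, so G[T′], T′ = T ∖ R, has minimum degree at least D + |P₂|, and a partial copy
-- of P₂ in G[T′] extends to a partial copy of P in G[T].
module Peel {h n} (H : Graph h) (G : Graph n) (P : Fin h → Bool) (T : Fin n → Bool)
            (i₀ : Fin h) (P-i₀ : P i₀ ≡ true) .{{_ : NonZero (count T)}}
            (copy : Copy H (Blowup.blowup (induced G (enum T)) n)) where

  open Blowup (induced G (enum T)) n

  g : Fin h → Fin n
  g = Copy.f copy

  inBlock : Fin h → Bool
  inBlock i = block (g i) ≡ᵇ block (g i₀)

  P₁ P₂ : Fin h → Bool
  P₁ i = P i ∧ inBlock i
  P₂ i = P i ∧ not (inBlock i)

  φ : Fin h → Fin n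
  φ i = enum T (pos (g i))

  preimages : Fin n → ℕ
  preimages u = count (λ i → P₁ i ∧ (φ i ≡ᶠ u))

  R T′ : Fin n → Bool
  R u = 0 <ᵇ preimages u
  T′ u = T u ∧ not (R u)

  split : count P ≡ count P₁ + count P₂
  split = trans (sum-cong-≗ pointwise) (∑-distrib-+ (λ i → ⟦ P₁ i ⟧) (λ i → ⟦ P₂ i ⟧))
    where
    pointwise : ∀ i → ⟦ P i ⟧ ≡ ⟦ P₁ i ⟧ + ⟦ P₂ i ⟧
    pointwise i with P i | inBlock i
    ... | true  | true  = refl
    ... | true  | false = refl
    ... | false | _     = refl

  P₂-smaller : ∀ c → count P ≤ suc c → count P₂ ≤ c
  P₂-smaller c |P|≤1+c = ≤-pred (begin
    suc (count P₂)          ≤⟨ +-monoˡ-≤ (count P₂) (member≤count P₁ i₀ P₁-i₀) ⟩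
    count P₁ + count P₂     ≡⟨ split ⟨
    count P                 ≤⟨ |P|≤1+c ⟩
    suc c ∎)
    where
    open ≤-Reasoning
    P₁-i₀ : P₁ i₀ ≡ true
    P₁-i₀ rewrite P-i₀ = ≡ᵇ-refl (block (g i₀))

  count-R : count R ≤ count P₁
  count-R = begin
    ∑[ u < n ] ⟦ R u ⟧                                  ≤⟨ ∑-mono n R≤preimages ⟩
    ∑[ u < n ] preimages u                              ≡⟨ ∑-comm (λ u i → ⟦ P₁ i ∧ (φ i ≡ᶠ u) ⟧) ⟩
    ∑[ i < h ] ∑[ u < n ] ⟦ P₁ i ∧ (φ i ≡ᶠ u) ⟧        ≤⟨ ∑-mono h at-most-one ⟩
    count P₁ ∎
    where
    open ≤-Reasoning
    R≤preimages : ∀ u → ⟦ R u ⟧ ≤ preimages u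
    R≤preimages u with preimages u
    ... | zero  = z≤n
    ... | suc _ = s≤s z≤n
    at-most-one : ∀ i → ∑[ u < n ] ⟦ P₁ i ∧ (φ i ≡ᶠ u) ⟧ ≤ ⟦ P₁ i ⟧
    at-most-one i with P₁ i
    ... | true  = count-≡ᶠ (φ i)
    ... | false = ≤-reflexive (sum-replicate-zero n)

  T′⊆T : ∀ u → T′ u ≡ true → T u ≡ true
  T′⊆T u = ∧-true-left (T u) _

  degree-loss : ∀ v → deg G T v ≤ deg G T′ v + count P₁
  degree-loss v = begin
    deg G T v                                       ≤⟨ ∑-mono n lost-only-in-R ⟩
    ∑[ u < n ] (⟦ T′ u ∧ adj G v u ⟧ + ⟦ R u ⟧)     ≡⟨ ∑-distrib-+ (λ u → ⟦ T′ u ∧ adj G v u ⟧) (λ u → ⟦ R u ⟧) ⟩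
    deg G T′ v + count R                             ≤⟨ +-monoʳ-≤ (deg G T′ v) count-R ⟩
    deg G T′ v + count P₁ ∎
    where
    open ≤-Reasoning
    lost-only-in-R : ∀ u → ⟦ T u ∧ adj G v u ⟧ ≤ ⟦ T′ u ∧ adj G v u ⟧ + ⟦ R u ⟧
    lost-only-in-R u with T u | R u | adj G v u
    ... | true  | true  | true  = s≤s z≤n
    ... | true  | true  | false = z≤n
    ... | true  | false | _     = m≤m+n _ _
    ... | false | _     | _     = z≤n

  min-degree-after : ∀ {D} → (∀ v → T v ≡ true → D + count P ≤ deg G T v) →
                     ∀ v → T v ≡ true → D + count P₂ ≤ deg G T′ v
  min-degree-after {D} deg≥ v Tv = +-cancelʳ-≤ (count P₁) (D + count P₂) (deg G T′ v) (begin
    D + count P₂ + count P₁       ≡⟨ +-assoc D (count P₂) (count P₁) ⟩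
    D + (count P₂ + count P₁)     ≡⟨ cong (D +_) (trans (+-comm (count P₂) (count P₁)) (sym split)) ⟩
    D + count P                   ≤⟨ deg≥ v Tv ⟩
    deg G T v                     ≤⟨ degree-loss v ⟩
    deg G T′ v + count P₁ ∎)
    where open ≤-Reasoning

  T′-nonempty : ∀ {D} → 1 ≤ D → (∀ v → T v ≡ true → D + count P ≤ deg G T v) →
                ∃[ v ] T v ≡ true → ∃[ u ] T′ u ≡ true
  T′-nonempty {D} D≥1 deg≥ (v , Tv) with ∑-positive n (λ u → ⟦ T′ u ∧ adj G v u ⟧) neighbour
    where
    neighbour : 1 ≤ deg G T′ v
    neighbour = ≤-trans (≤-trans D≥1 (m≤m+n D (count P₂))) (min-degree-after deg≥ v Tv)
  ... | u , pos = u , ∧-true-left (T′ u) _ (indicator-positive pos)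

  φ-hits-R : ∀ i → P₁ i ≡ true → R (φ i) ≡ true
  φ-hits-R i P₁i = <ᵇ-true (≤-trans (≤-reflexive (cong ⟦_⟧ (sym i-counted)))
                                     (term≤∑ h (λ j → ⟦ P₁ j ∧ (φ j ≡ᶠ φ i) ⟧) i))
    where
    i-counted : (P₁ i ∧ (φ i ≡ᶠ φ i)) ≡ true
    i-counted rewrite P₁i = ≡ᶠ-refl (φ i)

  T′-avoids-R : ∀ u → T′ u ≡ true → R u ≡ false
  T′-avoids-R u T′u with R u | ∧-true-right (T u) _ T′u
  ... | false | _ = refl

  -- φ is injective on P₁: same block (by definition) and same position means same vertex of H.
  φ-injective : ∀ i j → inBlock i ≡ true → inBlock j ≡ true → φ i ≡ φ j → i ≡ j
  φ-injective i j bi bj φi≡φj = Copy.inj copy (block-pos-injective (g i) (g j)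
    (trans (≡ᵇ-true _ _ bi) (sym (≡ᵇ-true _ _ bj))) (enum-injective T φi≡φj))

  -- An H-edge never leaves the block of i₀: blow-up edges stay inside blocks.
  no-edge-out : ∀ i j → inBlock i ≡ true → inBlock j ≡ false → adj H i j ≡ false
  no-edge-out i j bi bj with adj H i j in e
  ... | false = refl
  ... | true  = ⊥-elim (true≢false bj-true bj)
    where
    bj-true : inBlock j ≡ true
    bj-true = trans (cong (_≡ᵇ block (g i₀)) (sym (edge-block (g i) (g j) (Copy.preserve copy i j e)))) bi

  extend : PartialCopy H G P₂ T′ → PartialCopy H G P T
  extend c₂ = record { to = f ; into = into ; injective = injective ; preserve = preserve }
    where
    open PartialCopy c₂ renaming (to to f₂; into to into₂; injective to injective₂; preserve to preserve₂)
    f : Fin h → Fin n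
    f i = if inBlock i then φ i else f₂ i
    P₁-of : ∀ {i} → P i ≡ true → inBlock i ≡ true → P₁ i ≡ true
    P₁-of {i} Pi bi rewrite Pi | bi = refl
    P₂-of : ∀ {i} → P i ≡ true → inBlock i ≡ false → P₂ i ≡ true
    P₂-of {i} Pi bi rewrite Pi | bi = refl
    into : ∀ i → P i ≡ true → T (f i) ≡ true
    into i Pi with inBlock i in bi
    ... | true  = enum-member T (pos (g i))
    ... | false = T′⊆T (f₂ i) (into₂ i (P₂-of Pi bi))
    -- The images of P₁ (in R) and of P₂ (in T′, disjoint from R) do not meet.
    apart : ∀ i j → P i ≡ true → P j ≡ true → inBlock i ≡ true → inBlock j ≡ false → φ i ≢ f₂ j
    apart i j Pi Pj bi bj φi≡f₂j = true≢false
      (trans (sym (cong R φi≡f₂j)) (φ-hits-R i (P₁-of Pi bi))) (T′-avoids-R (f₂ j) (into₂ j (P₂-of Pj bj)))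
    injective : ∀ i j → P i ≡ true → P j ≡ true → f i ≡ f j → i ≡ j
    injective i j Pi Pj e with inBlock i in bi | inBlock j in bj
    ... | true  | true  = φ-injective i j bi bj e
    ... | false | false = injective₂ i j (P₂-of Pi bi) (P₂-of Pj bj) e
    ... | true  | false = ⊥-elim (apart i j Pi Pj bi bj e)
    ... | false | true  = ⊥-elim (apart j i Pj Pi bj bi (sym e))
    preserve : ∀ i j → P i ≡ true → P j ≡ true → adj H i j ≡ true → adj G (f i) (f j) ≡ true
    preserve i j Pi Pj e with inBlock i in bi | inBlock j in bj
    ... | true  | true  = edge-pos (g i) (g j) (Copy.preserve copy i j e)
    ... | false | false = preserve₂ i j (P₂-of Pi bi) (P₂-of Pj bj) e
    ... | true  | false = ⊥-elim (true≢false e (no-edge-out i j bi bj))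
    ... | false | true  = ⊥-elim (true≢false (trans (Graph.sym H j i) e) (no-edge-out j i bj bi))

count-all : ∀ h → count {h} (λ _ → true) ≡ h
count-all zero    = refl
count-all (suc h) = cong suc (count-all h)

module Embed {h n} (H : Graph h) (G : Graph n) (D : ℕ) (D≥1 : 1 ≤ D)
  (blowups-contain-H : ∀ (T : Fin n → Bool) (nz : NonZero (count T)) →
     (∀ v → T v ≡ true → D ≤ deg G T v) → ¬ ¬ Copy H (Blowup.blowup (induced G (enum T)) {{nz}} n)) where

  embed : ∀ c (P : Fin h → Bool) → count P ≤ c → ∀ (T : Fin n → Bool) → ∃[ v ] T v ≡ true →
          (∀ v → T v ≡ true → D + count P ≤ deg G T v) → ¬ ¬ PartialCopy H G P T
  embed c P |P|≤c T (v₀ , T-v₀) deg≥ with any? (λ i → P i ≟ true)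
  ... | no P-empty = λ noCopy → noCopy (record
        { to = λ _ → v₀ ; into = vacuous ; injective = λ i _ Pi → vacuous i Pi ; preserve = λ i _ Pi → vacuous i Pi })
    where
    vacuous : ∀ {A : Set} i → P i ≡ true → A
    vacuous i Pi = ⊥-elim (P-empty (i , Pi))
  ... | yes (i₀ , P-i₀) = peel c |P|≤c
    where
    nz = count-nonzero T (v₀ , T-v₀)
    peel : ∀ c → count P ≤ c → ¬ ¬ PartialCopy H G P T
    peel zero    |P|≤0   _      = 1+n≰n (≤-trans (member≤count P i₀ P-i₀) |P|≤0)
    peel (suc c) |P|≤1+c noCopy =
      blowups-contain-H T nz (λ v Tv → ≤-trans (m≤m+n D (count P)) (deg≥ v Tv)) λ copy →
        let open Peel H G P T i₀ P-i₀ {{nz}} copy in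
        embed c P₂ (P₂-smaller c |P|≤1+c) T′ (T′-nonempty D≥1 deg≥ (v₀ , T-v₀))
              (λ v T′v → min-degree-after deg≥ v (T′⊆T v T′v)) (noCopy ∘ extend)

  embed-H : ∀ (T : Fin n → Bool) → ∃[ v ] T v ≡ true → (∀ v → T v ≡ true → D + h ≤ deg G T v) →
            ¬ ¬ Copy H G
  embed-H T T≠∅ deg≥ noCopy =
    embed h all (≤-reflexive (count-all h)) T T≠∅
      (λ v Tv → subst (λ k → D + k ≤ deg G T v) (sym (count-all h)) (deg≥ v Tv))
      (λ c → noCopy (record
        { f = PartialCopy.to c
        ; inj = λ {i} {j} → PartialCopy.injective c i j refl refl
        ; preserve = λ i j → PartialCopy.preserve c i j refl refl }))
    where
    all : Fin h → Bool
    all _ = true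

isCentre : ∀ {n} → Fin n → Bool
isCentre zero    = true
isCentre (suc _) = false

Star : ∀ n → Graph n
Star n = record
  { adj    = λ x y → isCentre x xor isCentre y
  ; sym    = λ x y → xor-comm (isCentre x) (isCentre y)
  ; irrefl = λ x → xor-same (isCentre x)
  }

star-edge : ∀ {n} (x y : Fin n) → adj (Star n) x y ≡ true → isCentre x ≡ true ⊎ isCentre y ≡ true
star-edge zero    _       _ = inj₁ refl
star-edge (suc x) zero    _ = inj₂ refl

centre-unique : ∀ {n} (x y : Fin n) → isCentre x ≡ true → isCentre y ≡ true → x ≡ y
centre-unique zero zero _ _ = refl

star-edges : ∀ n → 2 ≤ n → n ≤ 4 * edges (Star n)
star-edges (suc n) (s≤s 1≤n) = begin
  suc n                              ≤⟨ +-monoˡ-≤ n 1≤n ⟩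
  n + n                              ≡⟨ cong (n +_) (+-identityʳ n) ⟨
  2 * n                              ≤⟨ *-monoʳ-≤ 2 (≤-trans centre-degree (term≤∑ (suc n) (degree S) zero)) ⟩
  2 * ∑[ x < suc n ] degree S x      ≤⟨ *-monoʳ-≤ 2 (handshake S) ⟩
  2 * (2 * edges S)                  ≡⟨ *-assoc 2 2 (edges S) ⟨
  4 * edges S ∎
  where
  open ≤-Reasoning
  S = Star (suc n)
  centre-degree : n ≤ degree S zero
  centre-degree = ≤-trans (≤-reflexive (sym (*-identityʳ n))) (const≤∑ n 1 (λ _ → 1) (λ _ → ≤-refl))

k₂-adj : Fin 2 → Fin 2 → Bool
k₂-adj zero       zero       = false
k₂-adj zero       (suc zero) = true
k₂-adj (suc zero) zero       = true
k₂-adj (suc zero) (suc zero) = false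

K₂ : Graph 2
K₂ = record { adj = k₂-adj ; sym = symmetric ; irrefl = irreflexive }
  where
  symmetric : ∀ p q → k₂-adj p q ≡ k₂-adj q p
  symmetric zero       zero       = refl
  symmetric zero       (suc zero) = refl
  symmetric (suc zero) zero       = refl
  symmetric (suc zero) (suc zero) = refl
  irreflexive : ∀ p → k₂-adj p p ≡ false
  irreflexive zero       = refl
  irreflexive (suc zero) = refl

K₂-unique-neighbour : ∀ p q r → k₂-adj p q ≡ true → k₂-adj p r ≡ true → q ≡ r
K₂-unique-neighbour zero       zero       _          () _
K₂-unique-neighbour zero       (suc zero) zero       _  ()
K₂-unique-neighbour zero       (suc zero) (suc zero) _  _  = refl
K₂-unique-neighbour (suc zero) zero       zero       _  _  = refl
K₂-unique-neighbour (suc zero) zero       (suc zero) _  ()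
K₂-unique-neighbour (suc zero) (suc zero) _          () _

Matching : ∀ n → Graph n
Matching n = Blowup.blowup K₂ n

matching-edges : ∀ n → 2 ≤ n → n ≤ 4 * edges (Matching n)
matching-edges n 2≤n = subst (_≤ 4 * edges (Matching n)) (+-identityʳ n)
  (Blowup.blowup-edges K₂ n 1 (λ { zero → ≤-refl ; (suc zero) → ≤-refl }) 2≤n)

matching-unique-neighbour : ∀ {n} (x y z : Fin n) →
  adj (Matching n) x y ≡ true → adj (Matching n) x z ≡ true → y ≡ z
matching-unique-neighbour {n} x y z xy xz = block-pos-injective y z
  (trans (sym (edge-block x y xy)) (edge-block x z xz))
  (K₂-unique-neighbour (pos x) (pos y) (pos z) (edge-pos x y xy) (edge-pos x z xz))
  where open Blowup K₂ n

module OneEdge {h n₁ n₂} (H : Graph h) (cm : Copy H (Matching n₁)) (cs : Copy H (Star n₂)) where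

  flip : ∀ a b → adj H a b ≡ true → adj H b a ≡ true
  flip a b e = trans (Graph.sym H b a) e

  unique-neighbour : ∀ a b c → adj H a b ≡ true → adj H a c ≡ true → b ≡ c
  unique-neighbour a b c ab ac = Copy.inj cm
    (matching-unique-neighbour (Copy.f cm a) (Copy.f cm b) (Copy.f cm c) (Copy.preserve cm a b ab) (Copy.preserve cm a c ac))

  central : ∀ a b → adj H a b ≡ true → isCentre (Copy.f cs a) ≡ true ⊎ isCentre (Copy.f cs b) ≡ true
  central a b ab = star-edge (Copy.f cs a) (Copy.f cs b) (Copy.preserve cs a b ab)

  same-central : ∀ a b → isCentre (Copy.f cs a) ≡ true → isCentre (Copy.f cs b) ≡ true → a ≡ b
  same-central a b ca cb = Copy.inj cs (centre-unique (Copy.f cs a) (Copy.f cs b) ca cb)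

  at-most-one-edge : ∀ i j x y → adj H i j ≡ true → adj H x y ≡ true → (x ≡ i × y ≡ j) ⊎ (x ≡ j × y ≡ i)
  at-most-one-edge i j x y ij xy with central i j ij | central x y xy
  ... | inj₁ ci | inj₁ cx with same-central i x ci cx
  ...   | refl = inj₁ (refl , sym (unique-neighbour i j y ij xy))
  at-most-one-edge i j x y ij xy | inj₁ ci | inj₂ cy with same-central i y ci cy
  ...   | refl = inj₂ (sym (unique-neighbour i j x ij (flip x i xy)) , refl)
  at-most-one-edge i j x y ij xy | inj₂ cj | inj₁ cx with same-central j x cj cx
  ...   | refl = inj₂ (refl , sym (unique-neighbour j i y (flip i j ij) xy))
  at-most-one-edge i j x y ij xy | inj₂ cj | inj₂ cy with same-central j y cj cy
  ...   | refl = inj₁ (sym (unique-neighbour j i x (flip i j ij) (flip x j xy)) , refl)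

transpose-left : ∀ {n} (a b : Fin n) → transpose a b a ≡ b
transpose-left a b rewrite dec-true (a Fin.≟ a) refl = refl

transpose-other : ∀ {n} (a b x : Fin n) → x ≢ a → x ≢ b → transpose a b x ≡ x
transpose-other a b x x≢a x≢b rewrite dec-false (x Fin.≟ a) x≢a | dec-false (x Fin.≟ b) x≢b = refl

transpose-injective : ∀ {n} (a b : Fin n) → Injective _≡_ _≡_ (transpose a b)
transpose-injective a b {x} {y} e = begin
  x                             ≡⟨ transpose-inverse b a ⟨
  transpose b a (transpose a b x) ≡⟨ cong (transpose b a) e ⟩
  transpose b a (transpose a b y) ≡⟨ transpose-inverse b a ⟩
  y ∎
  where open ≡-Reasoning

-- A graph H with at most one edge embeds into every graph with an edge vu and at least h vertices:
-- place H's edge ij onto vu by two transpositions of the inclusion Fin h ↪ Fin n.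
one-edge-copy : ∀ {h n} (H : Graph h) (G : Graph n) → h ≤ n → ∀ v u → adj G v u ≡ true →
  (∀ i j x y → adj H i j ≡ true → adj H x y ≡ true → (x ≡ i × y ≡ j) ⊎ (x ≡ j × y ≡ i)) → Copy H G
one-edge-copy {h} {n} H G h≤n v u vu one-edge
  with any? (λ i → any? (λ j → adj H i j ≟ true))
... | no no-edge = record
  { f = ι ; inj = ι-injective ; preserve = λ i j ij → ⊥-elim (no-edge (i , j , ij)) }
  where
  ι : Fin h → Fin n
  ι i = inject≤ i h≤n
  ι-injective : Injective _≡_ _≡_ ι
  ι-injective {i} {j} = inject≤-injective h≤n h≤n i j
... | yes (i , j , ij) = record { f = f ; inj = f-injective ; preserve = preserve }
  where
  ι : Fin h → Fin n
  ι i = inject≤ i h≤n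
  ι-injective : Injective _≡_ _≡_ ι
  ι-injective {i} {j} = inject≤-injective h≤n h≤n i j
  σ : Fin n → Fin n
  σ = transpose (ι i) v
  f : Fin h → Fin n
  f k = transpose (σ (ι j)) u (σ (ι k))
  f-injective : Injective _≡_ _≡_ f
  f-injective e = ι-injective (transpose-injective _ _ (transpose-injective _ _ e))
  distinct : ∀ {m} {G : Graph m} {a b} → adj G a b ≡ true → a ≢ b
  distinct {G = G} {a} ab refl = true≢false ab (irrefl G a)
  f-i : f i ≡ v
  f-i = begin
    transpose (σ (ι j)) u (σ (ι i)) ≡⟨ cong (transpose (σ (ι j)) u) (transpose-left (ι i) v) ⟩
    transpose (σ (ι j)) u v         ≡⟨ transpose-other (σ (ι j)) u v v≢σιj (distinct {G = G} vu) ⟩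
    v ∎
    where
    open ≡-Reasoning
    v≢σιj : v ≢ σ (ι j)
    v≢σιj e = distinct {G = H} ij (ι-injective (transpose-injective (ι i) v (trans (transpose-left (ι i) v) e)))
  f-j : f j ≡ u
  f-j = transpose-left (σ (ι j)) u
  preserve : ∀ x y → adj H x y ≡ true → adj G (f x) (f y) ≡ true
  preserve x y xy with one-edge i j x y ij xy
  ... | inj₁ (refl , refl) rewrite f-i | f-j = vu
  ... | inj₂ (refl , refl) rewrite f-i | f-j = trans (Graph.sym G u v) vu

-- Lower bounds on ex(n, H) from H-free graphs with many edges.  They are proved by contradiction,
-- which is legitimate since the inequalities are decidable: if the bound fails, every graph K
-- with enough edges must contain H.
forced-copy : ∀ {h n} {H : Graph h} {e} → IsEx n H e → ∀ a b (K : Graph n) →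
  a ≤ b * edges K → ¬ (a ≤ b * e) → ¬ ¬ Copy H K
forced-copy ex a b K many fails noCopy = fails (≤-trans many (*-monoʳ-≤ b (proj₂ ex K noCopy)))

-- Dense case: if G is H-free and some non-empty G[T] has minimum degree at least D + h, D ≥ 1,
-- then ex(n, H) ≥ Dn/4.  Some blow-up of a G[T′] with minimum degree ≥ D must be H-free.
dense-bound : ∀ {h n} (H : Graph h) (G : Graph n) → Free H G → ∀ {e} → IsEx n H e →
  ∀ D → 1 ≤ D → ∀ (T : Fin n → Bool) → ∃[ v ] T v ≡ true →
  (∀ v → T v ≡ true → D + h ≤ deg G T v) → D * n ≤ 4 * e
dense-bound {h} {n} H G free {e} ex D D≥1 T T≠∅ deg≥ =
  decidable-stable (D * n ≤? 4 * e) λ fails → Embed.embed-H H G D D≥1 (blowups-contain-H fails) T T≠∅ deg≥ free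
  where
  blowups-contain-H : ¬ (D * n ≤ 4 * e) → ∀ (T′ : Fin n → Bool) (nz : NonZero (count T′)) →
    (∀ v → T′ v ≡ true → D ≤ deg G T′ v) → ¬ ¬ Copy H (Blowup.blowup (induced G (enum T′)) {{nz}} n)
  blowups-contain-H fails T′ nz deg≥D = forced-copy ex (D * n) 4 _
    (Blowup.blowup-edges (induced G (enum T′)) {{nz}} n D
      (λ r → subst (D ≤_) (sym (degree-induced G T′ r)) (deg≥D (enum T′ r) (enum-member T′ r)))
      (count≤n T′))
    fails

-- Sparse case: if G is H-free and has an edge, then ex(n, H) ≥ n/4, since the matching or
-- the star is H-free (otherwise H, having at most one edge, would embed into G).
sparse-bound : ∀ {h n} (H : Graph h) (G : Graph n) → Free H G → ∀ {e} → IsEx n H e →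
  ∀ v u → adj G v u ≡ true → n ≤ 4 * e
sparse-bound {h} {n} H G free {e} ex v u vu = decidable-stable (n ≤? 4 * e) λ fails →
  forced-copy ex n 4 (Matching n) (matching-edges n 2≤n) fails λ cm →
  forced-copy ex n 4 (Star n) (star-edges n 2≤n) fails λ cs →
  free (one-edge-copy H G (injective⇒≤ (Copy.inj cs)) v u vu (OneEdge.at-most-one-edge H cm cs))
  where
  2≤n : 2 ≤ n
  2≤n = injective⇒≤ {f = endpoint} endpoint-injective
    where
    endpoint : Fin 2 → Fin n
    endpoint zero       = v
    endpoint (suc zero) = u
    v≢u : v ≢ u
    v≢u refl = true≢false vu (irrefl G v)
    endpoint-injective : Injective _≡_ _≡_ endpoint
    endpoint-injective {zero}     {zero}     _ = refl
    endpoint-injective {zero}     {suc zero} e = ⊥-elim (v≢u e)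
    endpoint-injective {suc zero} {zero}     e = ⊥-elim (v≢u (sym e))
    endpoint-injective {suc zero} {suc zero} _ = refl

module DenseArithmetic (h d : ℕ) (2h≤d : 2 * h ≤ d) where

  h+h≤d : h + h ≤ d
  h+h≤d = subst (_≤ d) (cong (h +_) (+-identityʳ h)) 2h≤d

  D+h≡d : (d ∸ h) + h ≡ d
  D+h≡d = m∸n+n≡m (m+n≤o⇒n≤o h h+h≤d)

  d≤2D : d ≤ 2 * (d ∸ h)
  d≤2D = begin
    d                       ≡⟨ D+h≡d ⟨
    (d ∸ h) + h             ≤⟨ +-monoʳ-≤ (d ∸ h) (m+n≤o⇒m≤o∸n h h+h≤d) ⟩
    (d ∸ h) + (d ∸ h)       ≡⟨ cong ((d ∸ h) +_) (+-identityʳ (d ∸ h)) ⟨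
    2 * (d ∸ h) ∎
    where open ≤-Reasoning

  D≥1 : 1 ≤ d → 1 ≤ d ∸ h
  D≥1 d≥1 with d ∸ h | d≤2D
  ... | zero  | d≤0 = ⊥-elim (1+n≰n (≤-trans d≥1 d≤0))
  ... | suc _ | _   = s≤s z≤n

  dense-arithmetic : ∀ n e → (d ∸ h) * n ≤ 4 * e → d * n ≤ (8 + 8 * h) * e
  dense-arithmetic n e Dn≤4e = begin
    d * n                   ≤⟨ *-monoˡ-≤ n d≤2D ⟩
    2 * (d ∸ h) * n         ≡⟨ *-assoc 2 (d ∸ h) n ⟩
    2 * ((d ∸ h) * n)       ≤⟨ *-monoʳ-≤ 2 Dn≤4e ⟩
    2 * (4 * e)             ≡⟨ *-assoc 2 4 e ⟨
    8 * e                   ≤⟨ *-monoˡ-≤ e (m≤m+n 8 (8 * h)) ⟩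
    (8 + 8 * h) * e ∎
    where open ≤-Reasoning

sparse-arithmetic : ∀ h d n e → d < 2 * h → n ≤ 4 * e → d * n ≤ (8 + 8 * h) * e
sparse-arithmetic h d n e d<2h n≤4e = begin
  d * n                     ≤⟨ *-monoˡ-≤ n (<⇒≤ d<2h) ⟩
  2 * h * n                 ≤⟨ *-monoʳ-≤ (2 * h) n≤4e ⟩
  2 * h * (4 * e)           ≡⟨ regroup h e ⟩
  8 * h * e                 ≤⟨ *-monoˡ-≤ e (m≤n+m (8 * h) 8) ⟩
  (8 + 8 * h) * e ∎
  where
  open ≤-Reasoning
  regroup : ∀ h e → 2 * h * (4 * e) ≡ 8 * h * e
  regroup = solve-∀

lemma4 : ∀ {h} (H : Graph h) → ∃[ C ] (∀ (n : ℕ) (G : Graph n) → Free H G → ∀ (e : ℕ) → IsEx n H e → dg G * n ≤ C * e)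
lemma4 {h} H = 8 + 8 * h , bound
  where
  bound : ∀ (n : ℕ) (G : Graph n) → Free H G → ∀ (e : ℕ) → IsEx n H e → dg G * n ≤ (8 + 8 * h) * e
  bound n G free e ex with 1 ≤? dg G
  ... | no dg≱1 = subst (λ d → d * n ≤ (8 + 8 * h) * e) (sym (n<1⇒n≡0 (≰⇒> dg≱1))) z≤n
  ... | yes dg≥1 with dg-core G dg≥1 | 2 * h ≤? dg G
  ...   | T , T≠∅ , deg≥dg | yes dense = dense-arithmetic n e
          (dense-bound H G free ex (dg G ∸ h) (D≥1 dg≥1) T T≠∅
            (λ v Tv → subst (_≤ deg G T v) (sym D+h≡d) (deg≥dg v Tv)))
    where open DenseArithmetic h (dg G) dense
  ...   | T , (v , Tv) , deg≥dg | no sparse with has-neighbour G T v (≤-trans dg≥1 (deg≥dg v Tv))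
  ...     | u , vu = sparse-arithmetic h (dg G) n e (≰⇒> sparse) (sparse-bound H G free ex v u vu)
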